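{- Let $k,h,j\geq 2$ be integers with $k\geq j$. Let $P$ be a vertex-labeled path of length $j$ and let $\eta=2kh$. Let $G$ be a graph and let $\mathcal F$ be an $\eta$-robust family of copies of $P$ in $G$. Let $F\in\mathcal F$. Let $F_0=F$ if $k\equiv j\pmod 2$, and let $F_0$ be a subpath of $F$ of length $j-1$ if $k\not\equiv j\pmod 2$. Then the endpoints of $F_0$ are $(k,h)$-linked in $G$.
   Context: A vertex-labeled tree $T$ has vertices labeled $1,\dots,v(T)$; its leaf vector lists its leaves in increasing label order. A copy of $T$ in $G$ is an injective edge-preserving map $\phi:V(T)\to V(G)$; its leaf vector is the image of the leaf vector of $T$; for a subtree $D$ of $T$, $F[D]$ (the $D$-projection of $F$) is the restriction of $F$ to $D$. A family $\mathcal F$ of copies of $T$ is $\eta$-robust if (i) for every $F\in\mathcal F$ with leaf vector $\langle y_1,\dots,y_p\rangle$ there are $\eta$ members of $\mathcal F$ with this leaf vector that are pairwise vertex-disjoint apart from $\{y_1,\dots,y_p\}$, and (ii) for every $F\in\mathcal F$ and every pair of subtrees $T_1\subseteq T_2$ of $T$ with $|V(T_2)|=|V(T_1)|+1$, the set $\{F'[T_2]: F'\in\mathcal F,\ F'[T_1]=F[T_1]\}$ has at least $\eta$ elements. Two vertices $x,y$ are $(k,h)$-linked in $G$ if $G$ contains $h$ paths of length $k$ from $x$ to $y$ that are pairwise internally vertex-disjoint. -}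

module Defs where

open import Data.Nat using (ℕ; zero; suc; _+_; _*_; _≤_; _<_; _%_)
open import Data.Fin using (Fin; toℕ; inject₁; fromℕ) renaming (zero to fzero; suc to fsuc)
open import Data.Product using (Σ; _×_; _,_; ∃)
open import Data.Sum using (_⊎_)
open import Relation.Binary.PropositionalEquality using (_≡_; _≢_)
open import Relation.Nullary using (¬_)
open import Function.Definitions using (Injective)

record Graph (n : ℕ) : Set₁ where
  field
    Adj   : Fin n → Fin n → Set
    sym   : ∀ {x y} → Adj x y → Adj y x
    irrefl : ∀ {x} → ¬ Adj x x
open Graph public

-- A vertex-labeled path of length j: its vertices are the labels Fin (suc j)
-- (label ℓ stands for ℓ+1), and `ord p` is the label of the vertex at
-- position p along the path (positions 0,…,j). ord is injective, hence a
-- bijection; edges of P are {ord p, ord (p+1)}.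
record LabeledPath (j : ℕ) : Set where
  field
    ord     : Fin (suc j) → Fin (suc j)
    ord-inj : Injective _≡_ _≡_ ord
open LabeledPath public

record IsCopy {n j : ℕ} (G : Graph n) (P : LabeledPath j) (φ : Fin (suc j) → Fin n) : Set where
  field
    inj  : Injective _≡_ _≡_ φ
    edge : ∀ (p : Fin j) → Adj G (φ (ord P (inject₁ p))) (φ (ord P (fsuc p)))

Family : ℕ → ℕ → Set₁
Family n j = (Fin (suc j) → Fin n) → Set

-- The two leaves of P are the vertices at positions 0 and j (j ≥ 1).
-- Two copies have the same leaf vector iff they agree on both leaves
-- (the leaf vector is the images of the leaves in increasing label order).
SameLeafVector : ∀ {n j} → LabeledPath j → (Fin (suc j) → Fin n) → (Fin (suc j) → Fin n) → Set
SameLeafVector P φ ψ = φ (ord P fzero) ≡ ψ (ord P fzero) × φ (ord P (fromℕ _)) ≡ ψ (ord P (fromℕ _))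

-- Subtrees of a path P are exactly its nonempty subpaths: the vertices at
-- positions lo,…,hi with lo ≤ hi.  A subtree is given by its pair (lo , hi).
InSub : ∀ {j} → ℕ → ℕ → Fin (suc j) → Set
InSub lo hi p = lo ≤ toℕ p × toℕ p ≤ hi

ProjEq : ∀ {n j} → LabeledPath j → ℕ → ℕ → (Fin (suc j) → Fin n) → (Fin (suc j) → Fin n) → Set
ProjEq P lo hi φ ψ = ∀ p → InSub lo hi p → φ (ord P p) ≡ ψ (ord P p)

record Robust {n j : ℕ} (G : Graph n) (P : LabeledPath j) (η : ℕ) (𝓕 : Family n j) : Set where
  field
    copies : ∀ φ → 𝓕 φ → IsCopy G P φ
    disj : ∀ φ → 𝓕 φ →
      Σ (Fin η → (Fin (suc j) → Fin n)) λ g →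
        (∀ i → 𝓕 (g i)) ×
        (∀ i → SameLeafVector P (g i) φ) ×
        (∀ i i' → i ≢ i' → ∀ a b → g i a ≡ g i' b →
           (g i a ≡ φ (ord P fzero)) ⊎ (g i a ≡ φ (ord P (fromℕ _))))
    -- (ii) for subtrees T1 ⊆ T2 with |V(T2)| = |V(T1)| + 1, the set
    -- { F'[T2] : F' ∈ 𝓕, F'[T1] = F[T1] } has at least η elements
    ext : ∀ φ → 𝓕 φ → ∀ (lo₁ hi₁ lo₂ hi₂ : ℕ) →
      lo₁ ≤ hi₁ → hi₂ ≤ j → lo₂ ≤ lo₁ → hi₁ ≤ hi₂ →
      hi₂ + lo₁ ≡ suc (hi₁ + lo₂) →
      Σ (Fin η → (Fin (suc j) → Fin n)) λ g →
        (∀ i → 𝓕 (g i)) ×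
        (∀ i → ProjEq P lo₁ hi₁ (g i) φ) ×
        (∀ i i' → i ≢ i' → ¬ ProjEq P lo₂ hi₂ (g i) (g i'))

record IsPathOfLength {n : ℕ} (G : Graph n) (k : ℕ) (x y : Fin n) (π : Fin (suc k) → Fin n) : Set where
  field
    inj   : Injective _≡_ _≡_ π
    edge  : ∀ (p : Fin k) → Adj G (π (inject₁ p)) (π (fsuc p))
    start : π fzero ≡ x
    end   : π (fromℕ k) ≡ y

Internal : ∀ {k} → Fin (suc k) → Set
Internal {k} p = 0 < toℕ p × toℕ p < k

Linked : {n : ℕ} → Graph n → ℕ → ℕ → Fin n → Fin n → Set
Linked {n} G k h x y =
  Σ (Fin h → Fin (suc k) → Fin n) λ π →
    (∀ i → IsPathOfLength G k x y (π i)) ×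
    (∀ i i' → i ≢ i' → ∀ p q → Internal p → Internal q → π i p ≢ π i' q)

{-# OPTIONS --safe #-}
module Submission where

-- Robustness lets a copy of P be re-routed away from any set X of fewer than η vertices.
-- By (i), the η siblings of a copy with the same leaves are disjoint apart from the leaves,
-- so one of them has no interior vertex in X; by (ii), the η re-extensions of a copy at an
-- end position differ there, so one of them puts its new end vertex outside X.
-- A path of length j + 2t between the leaves of F is built by induction on t: step from the
-- first leaf to the second vertex of a sibling, then to the new first vertex of a
-- re-extension of that sibling, and continue from there; each detour costs two edges.
-- Stepping instead from the second (or penultimate) vertex of F to the new end vertex of a
-- re-extension of F gives the paths of length j + 2t + 1 between the ends of the two
-- subpaths of length j - 1.  Every such path of length k can avoid any set of fewer than
-- η - k vertices, so h internally disjoint ones are found greedily once h (k + 1) ≤ η.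

open import Defs renaming (sym to adj-sym)
open import Data.Nat using (ℕ; zero; suc; _+_; _*_; _≤_; _<_; _%_; _∸_; z≤n; s≤s)
open import Data.Nat.DivMod using ([m+kn]%n≡m%n)
open import Data.Nat.Properties
  using (+-comm; +-suc; +-assoc; +-identityʳ; *-comm; +-monoˡ-≤; +-monoʳ-≤; +-monoʳ-<; *-monoʳ-≤;
         ≤-refl; ≤-trans; ≤-reflexive; ≤-pred; n≤1+n; n<1+n; m≤m+n; m≤n+m; m+n≤o⇒m≤o; m≤n⇒∃[o]m+o≡n;
         m≤n⇒m<n∨m≡n; <-irrefl; <⇒≤; <⇒≱; m<n⇒0<n∸m; ∸-monoʳ-<; _<?_; module ≤-Reasoning)
open import Data.Fin using (Fin; fromℕ; zero; toℕ)
open import Data.Fin using (inject₁; opposite) renaming (zero to fzero; suc to fsuc)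
open import Data.Fin.Properties
  using (toℕ-injective; toℕ-fromℕ; toℕ-inject₁; toℕ<n; opposite-prop; opposite-involutive; pigeonhole; <⇒≢; _≟_; any?; ¬∀⟶∃¬)
open import Data.List using (List; []; _∷_; length; tabulate; _++_; lookup)
open import Data.List.Properties using (length-++; length-tabulate)
open import Data.List.Membership.Propositional using (_∈_; _∉_)
open import Data.List.Membership.Propositional.Properties using (∈-tabulate⁺; ∈-++⁺ˡ; ∈-++⁺ʳ)
open import Data.List.Relation.Unary.Any as Any using (Any; here; there; index)
open import Data.List.Relation.Unary.Any.Properties using (lookup-index)
open import Data.Empty using (⊥; ⊥-elim)
open import Data.Product using (_×_; Σ; ∃-syntax; _,_)
open import Data.Sum using (_⊎_; inj₁; inj₂; [_,_])
open import Function using (_∘_)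
open import Relation.Binary.PropositionalEquality using (_≡_; _≢_; refl; sym; trans; cong; subst; subst₂; module ≡-Reasoning)
open import Relation.Nullary using (¬_; Dec)
open import Relation.Nullary.Decidable using (_×-dec_)

∃-unblocked : ∀ {m n} {Blocks : Fin m → Fin n → Set} → (∀ i v → Dec (Blocks i v)) →
  (∀ {i i' v} → i ≢ i' → Blocks i v → Blocks i' v → ⊥) →
  ∀ (X : List (Fin n)) → length X < m → ∃[ i ] ¬ Any (Blocks i) X
∃-unblocked {m} {Blocks = Blocks} blocks? blocks-one X |X|<m =
  ¬∀⟶∃¬ m _ (λ i → Any.any? (blocks? i) X) not-all-blocked
  where
  not-all-blocked : ¬ (∀ i → Any (Blocks i) X)
  not-all-blocked blocked with pigeonhole |X|<m (λ i → index (blocked i))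
  ... | i , i' , i<i' , same-slot =
    blocks-one (<⇒≢ i<i') (lookup-index (blocked i))
      (subst (λ s → Blocks i' (lookup X s)) (sym same-slot) (lookup-index (blocked i')))

even-or-odd : ∀ d → ∃[ t ] (d ≡ t * 2 ⊎ d ≡ suc (t * 2))
even-or-odd zero = zero , inj₁ refl
even-or-odd (suc d) with even-or-odd d
... | t , inj₁ refl = t , inj₂ refl
... | t , inj₂ refl = suc t , inj₁ refl

suc[m]%2≢m%2 : ∀ m → suc m % 2 ≢ m % 2
suc[m]%2≢m%2 zero ()
suc[m]%2≢m%2 (suc zero) ()
suc[m]%2≢m%2 (suc (suc m)) = suc[m]%2≢m%2 m

excess-parity : ∀ {j k} → j ≤ k →
  ∃[ t ] ((k ≡ t * 2 + j × k % 2 ≡ j % 2) ⊎ (k ≡ suc (t * 2 + j) × k % 2 ≢ j % 2))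
excess-parity {j} j≤k with m≤n⇒∃[o]m+o≡n j≤k
... | d , refl with even-or-odd d
... | t , inj₁ refl = t , inj₁ (+-comm j (t * 2) , [m+kn]%n≡m%n j t 2)
... | t , inj₂ refl = t , inj₂ (trans (+-suc j (t * 2)) (cong suc (+-comm j (t * 2))) , odd)
  where
  odd : (j + suc (t * 2)) % 2 ≢ j % 2
  odd same = suc[m]%2≢m%2 j (begin
    suc j % 2              ≡⟨ sym ([m+kn]%n≡m%n (suc j) t 2) ⟩
    (suc j + t * 2) % 2    ≡⟨ cong (_% 2) (sym (+-suc j (t * 2))) ⟩
    (j + suc (t * 2)) % 2  ≡⟨ same ⟩
    j % 2                  ∎)
    where open ≡-Reasoning

m+n<o⇒m<o : ∀ m {n o} → m + n < o → m < o
m+n<o⇒m<o m = m+n≤o⇒m≤o (suc m)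

h*[1+k]≤2*k*h : ∀ {k} h → 1 ≤ k → h * suc k ≤ 2 * k * h
h*[1+k]≤2*k*h {k} h 1≤k = begin
  h * suc k    ≤⟨ *-monoʳ-≤ h (+-monoˡ-≤ k 1≤k) ⟩
  h * (k + k)  ≡⟨ cong (λ m → h * (k + m)) (sym (+-identityʳ k)) ⟩
  h * (2 * k)  ≡⟨ *-comm h (2 * k) ⟩
  2 * k * h    ∎
  where open ≤-Reasoning

internal≢first : ∀ {K} {p : Fin (suc K)} → Internal p → p ≢ fzero
internal≢first (() , _) refl

internal≢last : ∀ {K} {p : Fin (suc K)} → Internal p → p ≢ fromℕ K
internal≢last {K} (_ , p<K) refl = <-irrefl (toℕ-fromℕ K) p<K

first-last-or-internal : ∀ {K} (p : Fin (suc K)) → p ≡ fzero ⊎ p ≡ fromℕ K ⊎ Internal p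
first-last-or-internal fzero = inj₁ refl
first-last-or-internal {K} (fsuc q) with m≤n⇒m<n∨m≡n (toℕ<n q)
... | inj₁ q+1<K = inj₂ (inj₂ (s≤s z≤n , q+1<K))
... | inj₂ q+1≡K = inj₂ (inj₁ (toℕ-injective (trans q+1≡K (sym (toℕ-fromℕ K)))))

opposite-injective : ∀ {K} {p q : Fin K} → opposite p ≡ opposite q → p ≡ q
opposite-injective {p = p} {q} e =
  trans (sym (opposite-involutive p)) (trans (cong opposite e) (opposite-involutive q))

opposite-inject₁ : ∀ {K} (p : Fin K) → opposite (inject₁ p) ≡ fsuc (opposite p)
opposite-inject₁ fzero = refl
opposite-inject₁ (fsuc p) = cong inject₁ (opposite-inject₁ p)

opposite-fromℕ : ∀ K → opposite (fromℕ K) ≡ fzero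
opposite-fromℕ zero = refl
opposite-fromℕ (suc K) = cong inject₁ (opposite-fromℕ K)

opposite-internal : ∀ {K} {p : Fin (suc K)} → Internal p → Internal (opposite p)
opposite-internal {K} {p} (0<p , p<K) rewrite opposite-prop p =
  m<n⇒0<n∸m p<K , ∸-monoʳ-< 0<p (<⇒≤ p<K)

module Paths {n : ℕ} (G : Graph n) where

  Avoids : ∀ {K} → (Fin (suc K) → Fin n) → List (Fin n) → Set
  Avoids {K} π X = ∀ p → Internal {K} p → π p ∉ X

  PathAvoiding : ℕ → Fin n → Fin n → List (Fin n) → Set
  PathAvoiding K x y X = Σ (Fin (suc K) → Fin n) λ π → IsPathOfLength G K x y π × Avoids π X

  prepend : ∀ {K x y v X} → Adj G v x → v ≢ y → x ∉ X →
    PathAvoiding K x y (v ∷ X) → PathAvoiding (suc K) v y X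
  prepend {K} {x} {y} {v} {X} v~x v≢y x∉X (π , π-path , π-avoids) =
    v∷π , record { inj = v∷π-injective ; edge = v∷π-edge ; start = refl ; end = end } , v∷π-avoids
    where
    open IsPathOfLength π-path
    v∷π : Fin (suc (suc K)) → Fin n
    v∷π fzero = v
    v∷π (fsuc p) = π p
    v∉π : ∀ p → v ≢ π p
    v∉π p v≡πp with first-last-or-internal p
    ... | inj₁ refl = irrefl G (subst (Adj G v) (sym (trans v≡πp start)) v~x)
    ... | inj₂ (inj₁ refl) = v≢y (trans v≡πp end)
    ... | inj₂ (inj₂ p-internal) = π-avoids p p-internal (here (sym v≡πp))
    v∷π-injective : ∀ {p q} → v∷π p ≡ v∷π q → p ≡ q
    v∷π-injective {fzero} {fzero} _ = refl
    v∷π-injective {fzero} {fsuc q} e = ⊥-elim (v∉π q e)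
    v∷π-injective {fsuc p} {fzero} e = ⊥-elim (v∉π p (sym e))
    v∷π-injective {fsuc p} {fsuc q} e = cong fsuc (inj e)
    v∷π-edge : ∀ p → Adj G (v∷π (inject₁ p)) (v∷π (fsuc p))
    v∷π-edge fzero = subst (Adj G v) (sym start) v~x
    v∷π-edge (fsuc p) = edge p
    v∷π-avoids : Avoids v∷π X
    v∷π-avoids (fsuc p) p-internal πp∈X with first-last-or-internal p
    ... | inj₁ refl = x∉X (subst (_∈ X) start πp∈X)
    ... | inj₂ (inj₁ refl) = internal≢last p-internal refl
    ... | inj₂ (inj₂ p-internal) = π-avoids p p-internal (there πp∈X)

  reverse : ∀ {K x y X} → PathAvoiding K x y X → PathAvoiding K y x X
  reverse {K} (π , π-path , π-avoids) =
    π ∘ opposite ,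
    record { inj = opposite-injective ∘ inj ; edge = reversed-edge ; start = end
           ; end = trans (cong π (opposite-fromℕ K)) start } ,
    λ p p-internal → π-avoids (opposite p) (opposite-internal p-internal)
    where
    open IsPathOfLength π-path
    reversed-edge : ∀ p → Adj G (π (opposite (inject₁ p))) (π (opposite (fsuc p)))
    reversed-edge p = subst (λ q → Adj G (π q) (π (inject₁ (opposite p)))) (sym (opposite-inject₁ p))
                        (adj-sym G (edge (opposite p)))

  InternallyDisjoint : ∀ {h K} → (Fin h → Fin (suc K) → Fin n) → Set
  InternallyDisjoint π = ∀ i i' → i ≢ i' → ∀ p q → Internal p → Internal q → π i p ≢ π i' q

  disjoint-avoiding-paths : ∀ {K x y B} → (∀ X → length X + K < B → PathAvoiding K x y X) →
    ∀ h X → length X + h * suc K ≤ B →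
    Σ (Fin h → Fin (suc K) → Fin n) λ π →
      (∀ i → IsPathOfLength G K x y (π i)) × InternallyDisjoint π × (∀ i → Avoids (π i) X)
  disjoint-avoiding-paths gen zero X _ = (λ ()) , (λ ()) , (λ ()) , (λ ())
  disjoint-avoiding-paths {K} {B = B} gen (suc h) X room with gen X room-first
    where
    room-first : length X + K < B
    room-first = begin-strict
      length X + K                    <⟨ +-monoʳ-< (length X) (n<1+n K) ⟩
      length X + suc K                ≤⟨ +-monoʳ-≤ (length X) (m≤m+n (suc K) (h * suc K)) ⟩
      length X + (suc K + h * suc K)  ≤⟨ room ⟩
      B                               ∎
      where open ≤-Reasoning
  ... | π₀ , π₀-path , π₀-avoids
    with disjoint-avoiding-paths gen h (tabulate π₀ ++ X) (≤-trans (≤-reflexive room-rest) room)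
    where
    room-rest : length (tabulate π₀ ++ X) + h * suc K ≡ length X + (suc K + h * suc K)
    room-rest = begin
      length (tabulate π₀ ++ X) + h * suc K          ≡⟨ cong (_+ h * suc K) (length-++ (tabulate π₀)) ⟩
      (length (tabulate π₀) + length X) + h * suc K  ≡⟨ cong (λ l → l + length X + h * suc K) (length-tabulate π₀) ⟩
      (suc K + length X) + h * suc K                 ≡⟨ cong (_+ h * suc K) (+-comm (suc K) (length X)) ⟩
      (length X + suc K) + h * suc K                 ≡⟨ +-assoc (length X) (suc K) (h * suc K) ⟩
      length X + (suc K + h * suc K)                 ∎
      where open ≡-Reasoning
  ... | πs , πs-path , πs-disjoint , πs-avoid = π , π-path , π-disjoint , π-avoids
    where
    π : Fin (suc h) → Fin (suc K) → Fin n
    π fzero = π₀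
    π (fsuc i) = πs i
    π-path : ∀ i → IsPathOfLength G K _ _ (π i)
    π-path fzero = π₀-path
    π-path (fsuc i) = πs-path i
    π-disjoint : InternallyDisjoint π
    π-disjoint fzero fzero 0≢0 = ⊥-elim (0≢0 refl)
    π-disjoint fzero (fsuc i') _ p q _ q-internal e =
      πs-avoid i' q q-internal (subst (_∈ tabulate π₀ ++ X) e (∈-++⁺ˡ (∈-tabulate⁺ {f = π₀} p)))
    π-disjoint (fsuc i) fzero _ p q p-internal _ e =
      πs-avoid i p p-internal (subst (_∈ tabulate π₀ ++ X) (sym e) (∈-++⁺ˡ (∈-tabulate⁺ {f = π₀} q)))
    π-disjoint (fsuc i) (fsuc i') i≢i' = πs-disjoint i i' (i≢i' ∘ cong fsuc)
    π-avoids : ∀ i → Avoids (π i) X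
    π-avoids fzero = π₀-avoids
    π-avoids (fsuc i) p p-internal πp∈X = πs-avoid i p p-internal (∈-++⁺ʳ (tabulate π₀) πp∈X)

  avoiding⇒linked : ∀ {K x y B} h → h * suc K ≤ B →
    (∀ X → length X + K < B → PathAvoiding K x y X) → Linked G K h x y
  avoiding⇒linked h room gen with disjoint-avoiding-paths gen h [] room
  ... | π , π-path , π-disjoint , _ = π , π-path , π-disjoint

module RobustPaths {n : ℕ} (G : Graph n) {j₀ : ℕ} (P : LabeledPath (suc (suc j₀)))
                   {η : ℕ} {𝓕 : Family n (suc (suc j₀))} (R : Robust G P η 𝓕) where

  open Paths G

  j : ℕ
  j = suc (suc j₀)

  first second penultimate last : Fin (suc j)
  first = fzero
  second = fsuc fzero
  penultimate = inject₁ (fromℕ (suc j₀))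
  last = fromℕ j

  second-internal : Internal second
  second-internal = s≤s z≤n , s≤s (s≤s z≤n)

  toℕ-penultimate : toℕ penultimate ≡ suc j₀
  toℕ-penultimate = trans (toℕ-inject₁ (fromℕ (suc j₀))) (toℕ-fromℕ (suc j₀))

  room-∷ : ∀ {m K} → m + suc K < η → suc m + K < η
  room-∷ {m} {K} = subst (_< η) (+-suc m K)

  at : (Fin (suc j) → Fin n) → Fin (suc j) → Fin n
  at φ p = φ (ord P p)

  copy-injective : ∀ {φ p q} → 𝓕 φ → at φ p ≡ at φ q → p ≡ q
  copy-injective φ∈ = ord-inj P ∘ IsCopy.inj (Robust.copies R _ φ∈)

  copy-distinct : ∀ {φ p q} → 𝓕 φ → p ≢ q → at φ p ≢ at φ q
  copy-distinct φ∈ p≢q = p≢q ∘ copy-injective φ∈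

  copy-path : ∀ {φ} → 𝓕 φ → IsPathOfLength G j (at φ first) (at φ last) (at φ)
  copy-path φ∈ = record
    { inj = copy-injective φ∈ ; edge = IsCopy.edge (Robust.copies R _ φ∈) ; start = refl ; end = refl }

  copy-adjacent : ∀ {φ} → 𝓕 φ → ∀ p → Adj G (at φ (inject₁ p)) (at φ (fsuc p))
  copy-adjacent φ∈ = IsPathOfLength.edge (copy-path φ∈)

  Interior : (Fin (suc j) → Fin n) → Fin n → Set
  Interior φ v = ∃[ p ] Internal p × at φ p ≡ v

  interior? : ∀ φ v → Dec (Interior φ v)
  interior? φ v = any? (λ p → (0 <? toℕ p ×-dec toℕ p <? j) ×-dec at φ p ≟ v)

  sibling-avoiding : ∀ {φ} → 𝓕 φ → ∀ X → length X < η →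
    ∃[ ψ ] 𝓕 ψ × SameLeafVector P ψ φ × Avoids (at ψ) X
  sibling-avoiding {φ} φ∈ X |X|<η with Robust.disj R φ φ∈
  ... | g , g∈ , same-leaves , disjoint with ∃-unblocked (λ i → interior? (g i)) unique X |X|<η
    where
    unique : ∀ {i i' v} → i ≢ i' → Interior (g i) v → Interior (g i') v → ⊥
    unique {i} {i'} i≢i' (p , p-internal , refl) (q , _ , e)
      with disjoint i i' i≢i' (ord P p) (ord P q) (sym e) | same-leaves i
    ... | inj₁ at-first | same-first , _ =
      internal≢first p-internal (copy-injective (g∈ i) (trans at-first (sym same-first)))
    ... | inj₂ at-last | _ , same-last =
      internal≢last p-internal (copy-injective (g∈ i) (trans at-last (sym same-last)))
  ... | i , unblocked =
    g i , g∈ i , same-leaves i , λ p p-internal v∈X → unblocked (Any.map (λ e → p , p-internal , e) v∈X)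

  extension-avoiding : ∀ {φ lo₁ hi₁ lo₂ hi₂} → 𝓕 φ →
    lo₁ ≤ hi₁ → hi₂ ≤ j → lo₂ ≤ lo₁ → hi₁ ≤ hi₂ → hi₂ + lo₁ ≡ suc (hi₁ + lo₂) →
    (new : Fin (suc j)) → (∀ p → InSub lo₂ hi₂ p → InSub lo₁ hi₁ p ⊎ p ≡ new) →
    ∀ X → length X < η → ∃[ ψ ] 𝓕 ψ × ProjEq P lo₁ hi₁ ψ φ × at ψ new ∉ X
  extension-avoiding {φ} {lo₁} {hi₁} {lo₂} {hi₂} φ∈ lo₁≤hi₁ hi₂≤j lo₂≤lo₁ hi₁≤hi₂ one-more
                     new covers X |X|<η
    with Robust.ext R φ φ∈ lo₁ hi₁ lo₂ hi₂ lo₁≤hi₁ hi₂≤j lo₂≤lo₁ hi₁≤hi₂ one-more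
  ... | g , g∈ , agree , distinct with ∃-unblocked (λ i v → at (g i) new ≟ v) unique X |X|<η
    where
    unique : ∀ {i i' v} → i ≢ i' → at (g i) new ≡ v → at (g i') new ≡ v → ⊥
    unique {i} {i'} i≢i' refl same-new = distinct i i' i≢i' λ p p∈ →
      [ (λ p∈₁ → trans (agree i p p∈₁) (sym (agree i' p p∈₁))) , (λ { refl → sym same-new }) ]
        (covers p p∈)
  ... | i , fresh = g i , g∈ i , agree i , fresh

  re-extension-at-first : ∀ {φ} → 𝓕 φ → ∀ X → length X < η →
    ∃[ ψ ] 𝓕 ψ × ProjEq P 1 j ψ φ × at ψ first ∉ X
  re-extension-at-first φ∈ = extension-avoiding φ∈ (s≤s z≤n) ≤-refl z≤n ≤-refl (+-suc j 0) first covers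
    where
    covers : ∀ p → InSub 0 j p → InSub 1 j p ⊎ p ≡ first
    covers fzero _ = inj₂ refl
    covers (fsuc p) (_ , p<j) = inj₁ (s≤s z≤n , p<j)

  re-extension-at-last : ∀ {φ} → 𝓕 φ → ∀ X → length X < η →
    ∃[ ψ ] 𝓕 ψ × ProjEq P 0 (suc j₀) ψ φ × at ψ last ∉ X
  re-extension-at-last φ∈ = extension-avoiding φ∈ z≤n ≤-refl z≤n (n≤1+n (suc j₀)) refl last covers
    where
    covers : ∀ p → InSub 0 j p → InSub 0 (suc j₀) p ⊎ p ≡ last
    covers p (_ , p≤j) with m≤n⇒m<n∨m≡n p≤j
    ... | inj₁ p<j = inj₁ (z≤n , ≤-pred p<j)
    ... | inj₂ p≡j = inj₂ (toℕ-injective (trans p≡j (sym (toℕ-fromℕ j))))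

  first⇝last : ∀ t {φ} → 𝓕 φ → ∀ X → length X + (t * 2 + j) < η →
    PathAvoiding (t * 2 + j) (at φ first) (at φ last) X
  second⇝last : ∀ t {φ} → 𝓕 φ → ∀ X → length X + suc (t * 2 + j) < η →
    PathAvoiding (suc (t * 2 + j)) (at φ second) (at φ last) X

  first⇝last zero φ∈ X room with sibling-avoiding φ∈ X (m+n<o⇒m<o (length X) room)
  ... | ψ , ψ∈ , (same-first , same-last) , ψ-avoids =
    subst₂ (λ x y → PathAvoiding j x y X) same-first same-last (at ψ , copy-path ψ∈ , ψ-avoids)
  first⇝last (suc t) {φ} φ∈ X room with sibling-avoiding φ∈ X (m+n<o⇒m<o (length X) room)
  ... | ψ , ψ∈ , (same-first , same-last) , ψ-avoids =
    prepend first~second (copy-distinct φ∈ λ ()) (ψ-avoids second second-internal) onward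
    where
    first~second : Adj G (at φ first) (at ψ second)
    first~second = subst (λ v → Adj G v (at ψ second)) same-first (copy-adjacent ψ∈ fzero)
    onward : PathAvoiding (suc (t * 2 + j)) (at ψ second) (at φ last) (at φ first ∷ X)
    onward = subst (λ y → PathAvoiding _ _ y (at φ first ∷ X)) same-last (second⇝last t ψ∈ _ (room-∷ room))

  second⇝last t {φ} φ∈ X room with re-extension-at-first φ∈ X (m+n<o⇒m<o (length X) room)
  ... | ψ , ψ∈ , agree , fresh = prepend second~new (copy-distinct φ∈ λ ()) fresh onward
    where
    second~new : Adj G (at φ second) (at ψ first)
    second~new = subst (λ v → Adj G v (at ψ first)) (agree second (s≤s z≤n , s≤s z≤n))
                   (adj-sym G (copy-adjacent ψ∈ fzero))
    onward : PathAvoiding (t * 2 + j) (at ψ first) (at φ last) (at φ second ∷ X)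
    onward = subst (λ y → PathAvoiding _ _ y (at φ second ∷ X)) (agree last (s≤s z≤n , ≤-reflexive (toℕ-fromℕ j)))
               (first⇝last t ψ∈ _ (room-∷ room))

  first⇝penultimate : ∀ t {φ} → 𝓕 φ → ∀ X → length X + suc (t * 2 + j) < η →
    PathAvoiding (suc (t * 2 + j)) (at φ first) (at φ penultimate) X
  first⇝penultimate t {φ} φ∈ X room with re-extension-at-last φ∈ X (m+n<o⇒m<o (length X) room)
  ... | ψ , ψ∈ , agree , fresh =
    reverse (prepend penultimate~new (copy-distinct φ∈ λ ()) fresh (reverse backward))
    where
    penultimate~new : Adj G (at φ penultimate) (at ψ last)
    penultimate~new = subst (λ v → Adj G v (at ψ last)) (agree penultimate (z≤n , ≤-reflexive toℕ-penultimate))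
                        (copy-adjacent ψ∈ (fromℕ (suc j₀)))
    backward : PathAvoiding (t * 2 + j) (at φ first) (at ψ last) (at φ penultimate ∷ X)
    backward = subst (λ x → PathAvoiding _ x _ (at φ penultimate ∷ X)) (agree first (z≤n , z≤n))
                 (first⇝last t ψ∈ _ (room-∷ room))

  window : ∀ (a b : Fin (suc j)) → toℕ b ≡ toℕ a + (j ∸ 1) →
    (a ≡ first × b ≡ penultimate) ⊎ (a ≡ second × b ≡ last)
  window fzero b b≡ = inj₁ (refl , toℕ-injective (trans b≡ (sym toℕ-penultimate)))
  window (fsuc fzero) b b≡ = inj₂ (refl , toℕ-injective (trans b≡ (sym (toℕ-fromℕ j))))
  window (fsuc (fsuc a)) b b≡ =
    ⊥-elim (<⇒≱ (toℕ<n b) (subst (suc j ≤_) (sym b≡) (s≤s (s≤s (m≤n+m (suc j₀) (toℕ a))))))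

  window-linked : ∀ t {h φ} → 𝓕 φ → h * suc (suc (t * 2 + j)) ≤ η →
    (a b : Fin (suc j)) → toℕ b ≡ toℕ a + (j ∸ 1) → Linked G (suc (t * 2 + j)) h (at φ a) (at φ b)
  window-linked t {h} φ∈ room a b b≡ with window a b b≡
  ... | inj₁ (refl , refl) = avoiding⇒linked h room (first⇝penultimate t φ∈)
  ... | inj₂ (refl , refl) = avoiding⇒linked h room (second⇝last t φ∈)

  linked-endpoints : ∀ {k h} → j ≤ k → h * suc k ≤ η → ∀ {φ} → 𝓕 φ →
    (k % 2 ≡ j % 2 → Linked G k h (at φ first) (at φ last)) ×
    (k % 2 ≢ j % 2 → (a b : Fin (suc j)) → toℕ b ≡ toℕ a + (j ∸ 1) → Linked G k h (at φ a) (at φ b))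
  linked-endpoints {h = h} j≤k room φ∈ with excess-parity j≤k
  ... | t , inj₁ (refl , same) =
    (λ _ → avoiding⇒linked h room (first⇝last t φ∈)) , (λ differ → ⊥-elim (differ same))
  ... | t , inj₂ (refl , differ) =
    (λ same → ⊥-elim (differ same)) , (λ _ → window-linked t φ∈ room)

-- Only h (k + 1) ≤ 2kh is used.
lemma3p8 : (k h j : ℕ) → 2 ≤ k → 2 ≤ h → 2 ≤ j → j ≤ k →
    {n : ℕ} (G : Graph n) (P : LabeledPath j) (𝓕 : Family n j) →
    Robust G P (2 * k * h) 𝓕 →
    (F : Fin (suc j) → Fin n) → 𝓕 F →
    (k % 2 ≡ j % 2 → Linked G k h (F (ord P zero)) (F (ord P (fromℕ j)))) ×
    (k % 2 ≢ j % 2 → (a b : Fin (suc j)) → toℕ b ≡ toℕ a + (j ∸ 1) →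
      Linked G k h (F (ord P a)) (F (ord P b)))
lemma3p8 k h _ 2≤k _ (s≤s (s≤s _)) j≤k G P _ R F F∈ =
  RobustPaths.linked-endpoints G P R j≤k (h*[1+k]≤2*k*h h (≤-trans (s≤s z≤n) 2≤k)) F∈
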